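{- Let $a,b,c$ be nonzero integers with $\gcd(a,b,c)=1$, not all of the same sign, and suppose that two of $a,b,c$ have a common factor $d\ge 3$. Then the equation $E: ax+by+cz=0$ is uncommon over $[n]$, i.e. $\limsup_{n\to\infty}\mu_E([n])<\frac14$.
   Context: $[n]=\{1,\dots,n\}$. $T_E([n])$ is the set of $(x,y,z)\in[n]^3$ with $ax+by+cz=0$. For a coloring $f:[n]\to\{ -1,1\}$, $M_E(f)$ is the set of $(x,y,z)\in T_E([n])$ with $f(x)=f(y)=f(z)$, $\mu_E(f)=|M_E(f)|/|T_E([n])|$, and $\mu_E([n])=\min_f\mu_E(f)$ over all colorings $f:[n]\to\{ -1,1\}$. -}

module Defs where

open import Data.Bool using (Bool; _∧_)
open import Data.Bool.Properties using () renaming (_≟_ to _≟ᵇ_)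
open import Data.Nat using (ℕ; suc)
open import Data.Integer using (ℤ; +_; _+_; _*_; 0ℤ)
open import Data.Integer.Properties using () renaming (_≟_ to _≟ℤ_)
open import Data.List using (List; map; upTo; concatMap; filter; length; _∷_; [])
open import Data.Product using (_×_; _,_)
open import Relation.Nullary.Decidable using (⌊_⌋)

interval : ℕ → List ℕ
interval n = map suc (upTo n)

cube : ℕ → List (ℕ × ℕ × ℕ)
cube n = concatMap (λ x → concatMap (λ y → map (λ z → (x , y , z)) (interval n)) (interval n)) (interval n)

solutions : ℤ → ℤ → ℤ → ℕ → List (ℕ × ℕ × ℕ)
solutions a b c n =
  filter (λ t → let (x , y , z) = t in (a * + x + b * + y + c * + z) ≟ℤ 0ℤ) (cube n)

countT : ℤ → ℤ → ℤ → ℕ → ℕ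
countT a b c n = length (solutions a b c n)

-- a 2-coloring; Bool stands for {-1,1}; only values on [n] matter
Coloring : Set
Coloring = ℕ → Bool

monochromatic : Coloring → ℕ × ℕ × ℕ → Bool
monochromatic f (x , y , z) = ⌊ f x ≟ᵇ f y ⌋ ∧ ⌊ f y ≟ᵇ f z ⌋

countM : ℤ → ℤ → ℤ → ℕ → Coloring → ℕ
countM a b c n f = length (Data.List.filterᵇ (monochromatic f) (solutions a b c n))

-- Colour x ∈ [n] by whether d divides x.  As d divides a and b but is coprime to c, the third coordinate
-- of every solution is divisible by d, so a monochromatic solution has all coordinates divisible by d.
-- Adding i (c, 0, -a) + j (0, c, -b) with 0 ≤ i, j < 3 to such a solution gives nine solutions, and all
-- these are distinct since x + c i mod d determines i (d ≥ 3, gcd (d, c) = 1).  This needs the solution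
-- to stay at distance 2 (|a| + |b| + |c|) from the boundary of [n]³; there are only O(n) solutions near
-- the boundary, while the mixed signs give ≫ n² solutions divisible by d.  Hence for large n at most
-- 1/9 + o(1) ≤ 1/8 of all solutions are monochromatic, i.e. μ_E ≤ 1/4 - 1/8.

module Submission where

open import Defs

module Uncommonness where

  open import Data.Bool using (T; T?; true)
  open import Data.Bool.Properties using (T-∧; T-≡) renaming (_≟_ to _≟ᵇ_)
  open import Data.Fin using (Fin; zero; suc)
  open import Data.Integer as ℤ using (ℤ; +_; +0; +[1+_]; -[1+_]; 0ℤ; ∣_∣)
  open import Data.Integer.Divisibility using (_∣_)
  import Data.Integer.Divisibility.Signed as Signed
  open import Data.Integer.GCD using (gcd)
  open import Data.Integer.Properties using (+-injective; abs-*)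
  import Data.Integer.Properties as ℤP
  open import Algebra.Properties.AbelianGroup ℤP.+-0-abelianGroup
    using () renaming (∙-cancelˡ to ℤ+-cancelˡ; ∙-cancelʳ to ℤ+-cancelʳ)
  open import Data.Integer.Tactic.RingSolver using (solve-∀)
  open import Data.List using (List; []; _∷_; length; filter; removeAt; cartesianProduct; _++_; map; concatMap; upTo)
  open import Data.List.Membership.Propositional using (_∈_)
  open import Data.List.Membership.Propositional.Properties
    using (∈-map⁺; ∈-map⁻; ∈-upTo⁺; ∈-upTo⁻; ∈-cartesianProduct⁺; ∈-cartesianProduct⁻; ∈-filter⁺; ∈-filter⁻)
  open import Data.List.Properties
    using (length-removeAt′; length-++; length-map; length-upTo; filter-accept; map-∘; map-concatMap; concatMap-cong)
  import Data.List.Relation.Unary.All as All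
  open import Data.List.Relation.Unary.AllPairs using (_∷_)
  open import Data.List.Relation.Unary.Any using (here; there; index)
  open import Data.List.Relation.Unary.Unique.Propositional using (Unique)
  import Data.List.Relation.Unary.Unique.Propositional.Properties as Unique
  open import Data.Nat using (ℕ; zero; suc; _+_; _*_; _∸_; _≤_; _<_; z≤n; s≤s; z<s; s≤s⁻¹; NonZero; >-nonZero)
  open import Data.Nat.Coprimality using (Coprime; coprime-divisor)
  import Data.Nat.Divisibility as ℕ
  open import Data.Nat.Divisibility using (_∣?_; _∣0; >⇒∤; ∣n⇒∣m*n; m∣m*n; ∣m∣n⇒∣m+n; ∣-trans)
  open import Data.Nat.DivMod using (_/_; _%_; m*n/n≡m; /-monoˡ-≤; m/n*n≤m; m≡m%n+[m/n]*n; m%n<n)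
  open import Data.Nat.GCD using (gcd-greatest)
  open import Data.Nat.Properties
  import Data.Nat.Tactic.RingSolver as ℕ-Solver
  open import Data.Product using (_×_; _,_; Σ; proj₁; proj₂)
  open import Data.Sum using (_⊎_; inj₁; inj₂)
  open import Function.Bundles using (_⇔_; mk⇔; Equivalence)
  open import Relation.Binary.PropositionalEquality
  open import Relation.Nullary using (¬_; yes; no; contradiction)
  open import Relation.Nullary.Decidable using (⌊_⌋; toWitness; fromWitness; _×-dec_; _⊎-dec_; ¬?)
  open import Relation.Unary using (Decidable)

  module _ {A : Set} where

    ∈-removeAt⁺ : ∀ {v w : A} {ys} (v∈ys : v ∈ ys) → w ∈ ys → w ≢ v → w ∈ removeAt ys (index v∈ys)
    ∈-removeAt⁺ (here refl) (here refl)  w≢v = contradiction refl w≢v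
    ∈-removeAt⁺ (here refl) (there w∈ys) _   = w∈ys
    ∈-removeAt⁺ (there _)   (here refl)  _   = here refl
    ∈-removeAt⁺ (there v∈ys) (there w∈ys) w≢v = there (∈-removeAt⁺ v∈ys w∈ys w≢v)

    length-filter-∷ : ∀ {P : A → Set} (P? : Decidable P) x xs →
      length (filter P? xs) ≤ length (filter P? (x ∷ xs))
    length-filter-∷ P? x xs with P? x
    ... | yes _ = n≤1+n _
    ... | no  _ = ≤-refl

    length-filter-mono : ∀ {P Q : A → Set} (P? : Decidable P) (Q? : Decidable Q) xs →
      (∀ {x} → x ∈ xs → P x → Q x) → length (filter P? xs) ≤ length (filter Q? xs)
    length-filter-mono P? Q? []       _   = z≤n
    length-filter-mono P? Q? (x ∷ xs) P⇒Q with ih ← length-filter-mono P? Q? xs (λ x∈ → P⇒Q (there x∈)) | P? x | Q? x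
    ... | yes _  | yes _  = s≤s ih
    ... | yes px | no ¬qx = contradiction (P⇒Q (here refl) px) ¬qx
    ... | no _   | yes _  = m≤n⇒m≤1+n ih
    ... | no _   | no _   = ih

    length-filter-⊎ : ∀ {P Q R : A → Set} (P? : Decidable P) (Q? : Decidable Q) (R? : Decidable R) xs →
      (∀ {x} → x ∈ xs → P x → Q x ⊎ R x) →
      length (filter P? xs) ≤ length (filter Q? xs) + length (filter R? xs)
    length-filter-⊎ P? Q? R? []       _     = z≤n
    length-filter-⊎ P? Q? R? (x ∷ xs) split with ih ← length-filter-⊎ P? Q? R? xs (λ x∈ → split (there x∈)) | P? x
    ... | no _  = ≤-trans ih (+-mono-≤ (length-filter-∷ Q? x xs) (length-filter-∷ R? x xs))
    ... | yes px with split (here refl) px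
    ...   | inj₁ qx rewrite filter-accept Q? {xs = xs} qx =
      s≤s (≤-trans ih (+-monoʳ-≤ _ (length-filter-∷ R? x xs)))
    ...   | inj₂ rx rewrite filter-accept R? {xs = xs} rx | +-suc (length (filter Q? (x ∷ xs))) (length (filter R? xs)) =
      s≤s (≤-trans ih (+-monoˡ-≤ _ (length-filter-∷ Q? x xs)))

  module _ {A B : Set} where

    length-≤-injection : ∀ {xs : List A} (g : A → B) (ys : List B) → Unique xs →
      (∀ {x} → x ∈ xs → g x ∈ ys) → (∀ {x y} → x ∈ xs → y ∈ xs → g x ≡ g y → x ≡ y) →
      length xs ≤ length ys
    length-≤-injection {[]}     g ys _                 _    _   = z≤n
    length-≤-injection {x ∷ xs} g ys (x∉xs ∷ unique) into inj =
      subst (suc (length xs) ≤_) (sym (length-removeAt′ ys (index gx∈ys)))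
        (s≤s (length-≤-injection g _ unique into′ (λ p q → inj (there p) (there q))))
      where
      gx∈ys = into (here refl)
      into′ : ∀ {w} → w ∈ xs → g w ∈ removeAt ys (index gx∈ys)
      into′ w∈xs = ∈-removeAt⁺ gx∈ys (into (there w∈xs))
        (λ gw≡gx → All.lookup x∉xs w∈xs (sym (inj (there w∈xs) (here refl) gw≡gx)))

    length-cartesianProduct : ∀ (xs : List A) (ys : List B) →
      length (cartesianProduct xs ys) ≡ length xs * length ys
    length-cartesianProduct []       ys = refl
    length-cartesianProduct (x ∷ xs) ys = begin
      length (map (x ,_) ys ++ cartesianProduct xs ys)          ≡⟨ length-++ (map (x ,_) ys) ⟩
      length (map (x ,_) ys) + length (cartesianProduct xs ys)  ≡⟨ cong₂ _+_ (length-map (x ,_) ys) (length-cartesianProduct xs ys) ⟩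
      length ys + length xs * length ys                         ∎
      where open ≡-Reasoning

  ∈-interval⁺ : ∀ {n x} → 0 < x → x ≤ n → x ∈ interval n
  ∈-interval⁺ {x = suc x} _ x<n = ∈-map⁺ suc (∈-upTo⁺ x<n)

  ∈-interval⁻ : ∀ {n x} → x ∈ interval n → 0 < x × x ≤ n
  ∈-interval⁻ x∈ with _ , y∈ , refl ← ∈-map⁻ suc x∈ = s≤s z≤n , ∈-upTo⁻ y∈

  interval-unique : ∀ n → Unique (interval n)
  interval-unique n = Unique.map⁺ suc-injective (Unique.upTo⁺ n)

  length-interval : ∀ n → length (interval n) ≡ n
  length-interval n = trans (length-map suc (upTo n)) (length-upTo n)

  Triple : Set
  Triple = ℕ × ℕ × ℕ

  InBox : ℕ → Triple → Set
  InBox n (x , y , z) = x ∈ interval n × y ∈ interval n × z ∈ interval n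

  cartesianProduct≡concatMap : ∀ {A B : Set} (xs : List A) (ys : List B) →
    cartesianProduct xs ys ≡ concatMap (λ x → map (x ,_) ys) xs
  cartesianProduct≡concatMap []       ys = refl
  cartesianProduct≡concatMap (x ∷ xs) ys = cong (map (x ,_) ys ++_) (cartesianProduct≡concatMap xs ys)

  cube≡cartesianProduct : ∀ n →
    cube n ≡ cartesianProduct (interval n) (cartesianProduct (interval n) (interval n))
  cube≡cartesianProduct n = sym (begin
    cartesianProduct [n] (cartesianProduct [n] [n])
      ≡⟨ cartesianProduct≡concatMap [n] _ ⟩
    concatMap (λ x → map (x ,_) (cartesianProduct [n] [n])) [n]
      ≡⟨ concatMap-cong (λ x → cong (map (x ,_)) (cartesianProduct≡concatMap [n] [n])) [n] ⟩
    concatMap (λ x → map (x ,_) (concatMap (λ y → map (y ,_) [n]) [n])) [n]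
      ≡⟨ concatMap-cong (λ x → map-concatMap (x ,_) _ [n]) [n] ⟩
    concatMap (λ x → concatMap (λ y → map (x ,_) (map (y ,_) [n])) [n]) [n]
      ≡⟨ concatMap-cong (λ x → concatMap-cong (λ y → sym (map-∘ [n])) [n]) [n] ⟩
    cube n ∎)
    where
    [n] = interval n
    open ≡-Reasoning

  ∈-cube⁺ : ∀ {n t} → InBox n t → t ∈ cube n
  ∈-cube⁺ {n} (x∈ , y∈ , z∈) =
    subst (_ ∈_) (sym (cube≡cartesianProduct n)) (∈-cartesianProduct⁺ x∈ (∈-cartesianProduct⁺ y∈ z∈))

  ∈-cube⁻ : ∀ {n t} → t ∈ cube n → InBox n t
  ∈-cube⁻ {n} t∈ with x∈ , yz∈ ← ∈-cartesianProduct⁻ _ _ (subst (_ ∈_) (cube≡cartesianProduct n) t∈) =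
    x∈ , ∈-cartesianProduct⁻ _ _ yz∈

  cube-unique : ∀ n → Unique (cube n)
  cube-unique n = subst Unique (sym (cube≡cartesianProduct n))
    (Unique.cartesianProduct⁺ (interval-unique n) (Unique.cartesianProduct⁺ (interval-unique n) (interval-unique n)))

  Solves : ℤ → ℤ → ℤ → Triple → Set
  Solves a b c (x , y , z) = a ℤ.* + x ℤ.+ b ℤ.* + y ℤ.+ c ℤ.* + z ≡ 0ℤ

  ∈-solutions⁺ : ∀ {a b c n t} → InBox n t → Solves a b c t → t ∈ solutions a b c n
  ∈-solutions⁺ box solves = ∈-filter⁺ _ (∈-cube⁺ box) solves

  ∈-solutions⁻ : ∀ {a b c n t} → t ∈ solutions a b c n → InBox n t × Solves a b c t
  ∈-solutions⁻ t∈ with t∈cube , solves ← ∈-filter⁻ _ t∈ = ∈-cube⁻ t∈cube , solves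

  solutions-unique : ∀ a b c n → Unique (solutions a b c n)
  solutions-unique a b c n = Unique.filter⁺ _ (cube-unique n)

  module Transport {a b c a′ b′ c′ : ℤ} (σ : Triple → Triple) (σ-injective : ∀ {s t} → σ s ≡ σ t → s ≡ t)
           (σ-InBox : ∀ {n t} → InBox n t → InBox n (σ t))
           (σ-Solves : ∀ {t} → Solves a b c t → Solves a′ b′ c′ (σ t)) where

    ∈-solutions : ∀ {n t} → t ∈ solutions a b c n → σ t ∈ solutions a′ b′ c′ n
    ∈-solutions {n} t∈ with box , solves ← ∈-solutions⁻ {a} {b} {c} {n} t∈ =
      ∈-solutions⁺ {a′} {b′} {c′} (σ-InBox box) (σ-Solves solves)

    countT-≤ : ∀ n → countT a b c n ≤ countT a′ b′ c′ n
    countT-≤ n =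
      length-≤-injection σ (solutions a′ b′ c′ n) (solutions-unique a b c n) (∈-solutions {n}) (λ _ _ → σ-injective)

    length-filter-solutions-≤ : ∀ {P Q : Triple → Set} (P? : Decidable P) (Q? : Decidable Q) →
      (∀ {t} → P t → Q (σ t)) → ∀ n →
      length (filter P? (solutions a b c n)) ≤ length (filter Q? (solutions a′ b′ c′ n))
    length-filter-solutions-≤ P? Q? P⇒Q n =
      length-≤-injection σ (filter Q? (solutions a′ b′ c′ n)) (Unique.filter⁺ P? (solutions-unique a b c n))
        (λ t∈ → let t∈sol , Pt = ∈-filter⁻ P? {xs = solutions a b c n} t∈ in
                ∈-filter⁺ Q? (∈-solutions {n} t∈sol) (P⇒Q Pt))
        (λ _ _ → σ-injective)

  swap₂₃ swap₁₃ : Triple → Triple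
  swap₂₃ (x , y , z) = x , z , y
  swap₁₃ (x , y , z) = z , y , x

  swap₂₃-InBox : ∀ {n t} → InBox n t → InBox n (swap₂₃ t)
  swap₂₃-InBox (x∈ , y∈ , z∈) = x∈ , z∈ , y∈

  swap₁₃-InBox : ∀ {n t} → InBox n t → InBox n (swap₁₃ t)
  swap₁₃-InBox (x∈ , y∈ , z∈) = z∈ , y∈ , x∈

  swap₂₃-Solves : ∀ a b c {t} → Solves a b c t → Solves a c b (swap₂₃ t)
  swap₂₃-Solves a b c {x , y , z} = trans (rearrange a b c (+ x) (+ y) (+ z))
    where
    rearrange : ∀ a b c x y z → a ℤ.* x ℤ.+ c ℤ.* z ℤ.+ b ℤ.* y ≡ a ℤ.* x ℤ.+ b ℤ.* y ℤ.+ c ℤ.* z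
    rearrange = solve-∀

  swap₁₃-Solves : ∀ a b c {t} → Solves a b c t → Solves c b a (swap₁₃ t)
  swap₁₃-Solves a b c {x , y , z} = trans (rearrange a b c (+ x) (+ y) (+ z))
    where
    rearrange : ∀ a b c x y z → c ℤ.* z ℤ.+ b ℤ.* y ℤ.+ a ℤ.* x ≡ a ℤ.* x ℤ.+ b ℤ.* y ℤ.+ c ℤ.* z
    rearrange = solve-∀

  -- The swaps are involutions, so cong swap inverts them.
  module Transport₂₃ (a b c : ℤ) =
    Transport {a} {b} {c} {a} {c} {b} swap₂₃ (cong swap₂₃) swap₂₃-InBox (swap₂₃-Solves a b c)
  module Transport₁₃ (a b c : ℤ) =
    Transport {a} {b} {c} {c} {b} {a} swap₁₃ (cong swap₁₃) swap₁₃-InBox (swap₁₃-Solves a b c)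

  countT-swap₂₃ : ∀ a b c n → countT a b c n ≡ countT a c b n
  countT-swap₂₃ a b c n = ≤-antisym (Transport₂₃.countT-≤ a b c n) (Transport₂₃.countT-≤ a c b n)

  countT-swap₁₃ : ∀ a b c n → countT a b c n ≡ countT c b a n
  countT-swap₁₃ a b c n = ≤-antisym (Transport₁₃.countT-≤ a b c n) (Transport₁₃.countT-≤ c b a n)

  monochromatic⇔ : ∀ f {x y z} → T (monochromatic f (x , y , z)) ⇔ (f x ≡ f y × f y ≡ f z)
  monochromatic⇔ f {x} {y} {z} = mk⇔
    (λ mono → let fx≡fy , fy≡fz = Equivalence.to (T-∧ {⌊ xy? ⌋}) mono in toWitness fx≡fy , toWitness fy≡fz)
    (λ (fx≡fy , fy≡fz) →
       Equivalence.from (T-∧ {⌊ xy? ⌋}) (fromWitness {a? = xy?} fx≡fy , fromWitness {a? = yz?} fy≡fz))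
    where
    xy? = f x ≟ᵇ f y
    yz? = f y ≟ᵇ f z

  monochromatic-swap₂₃ : ∀ f {t} → T (monochromatic f t) → T (monochromatic f (swap₂₃ t))
  monochromatic-swap₂₃ f mono with fx≡fy , fy≡fz ← Equivalence.to (monochromatic⇔ f) mono =
    Equivalence.from (monochromatic⇔ f) (trans fx≡fy fy≡fz , sym fy≡fz)

  monochromatic-swap₁₃ : ∀ f {t} → T (monochromatic f t) → T (monochromatic f (swap₁₃ t))
  monochromatic-swap₁₃ f mono with fx≡fy , fy≡fz ← Equivalence.to (monochromatic⇔ f) mono =
    Equivalence.from (monochromatic⇔ f) (sym fy≡fz , sym fx≡fy)

  countM-swap₂₃ : ∀ a b c n f → countM a b c n f ≡ countM a c b n f
  countM-swap₂₃ a b c n f = ≤-antisym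
    (Transport₂₃.length-filter-solutions-≤ a b c mono? mono? (monochromatic-swap₂₃ f) n)
    (Transport₂₃.length-filter-solutions-≤ a c b mono? mono? (monochromatic-swap₂₃ f) n)
    where mono? = λ t → T? (monochromatic f t)

  countM-swap₁₃ : ∀ a b c n f → countM a b c n f ≡ countM c b a n f
  countM-swap₁₃ a b c n f = ≤-antisym
    (Transport₁₃.length-filter-solutions-≤ a b c mono? mono? (monochromatic-swap₁₃ f) n)
    (Transport₁₃.length-filter-solutions-≤ c b a mono? mono? (monochromatic-swap₁₃ f) n)
    where mono? = λ t → T? (monochromatic f t)

  -- For n ≥ N some colouring has μ_E(f) ≤ 1/4 - 1/k, cross-multiplied.
  Uncommon : ℕ → ℤ → ℤ → ℤ → Set
  Uncommon k a b c = Σ ℕ λ N → (n : ℕ) → N ≤ n →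
    Σ Coloring λ f → 4 * k * countM a b c n f + 4 * countT a b c n ≤ k * countT a b c n

  Uncommon-swap₂₃ : ∀ {k} a b c → Uncommon k a c b → Uncommon k a b c
  Uncommon-swap₂₃ {k} a b c (N , bound) = N , λ n N≤n → let f , ineq = bound n N≤n in
    f , subst₂ (λ M T → 4 * k * M + 4 * T ≤ k * T) (sym (countM-swap₂₃ a b c n f)) (sym (countT-swap₂₃ a b c n)) ineq

  Uncommon-swap₁₃ : ∀ {k} a b c → Uncommon k c b a → Uncommon k a b c
  Uncommon-swap₁₃ {k} a b c (N , bound) = N , λ n N≤n → let f , ineq = bound n N≤n in
    f , subst₂ (λ M T → 4 * k * M + 4 * T ≤ k * T) (sym (countM-swap₁₃ a b c n f)) (sym (countT-swap₁₃ a b c n)) ineq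

  -- Colouring by divisibility

  divisibleBy : ℕ → Coloring
  divisibleBy d x = ⌊ d ∣? x ⌋

  divisibleBy-true⇔ : ∀ {d x} → divisibleBy d x ≡ true ⇔ d ℕ.∣ x
  divisibleBy-true⇔ = mk⇔ (λ e → toWitness (Equivalence.from T-≡ e)) (λ d∣x → Equivalence.to T-≡ (fromWitness d∣x))

  ∣-third-coordinate : ∀ {a b c d x y z} → + d ∣ a → + d ∣ b → Coprime d ∣ c ∣ →
    Solves a b c (x , y , z) → d ℕ.∣ z
  ∣-third-coordinate {a} {b} {c} {d} {x} {y} {z} d∣a d∣b coprime solves =
    coprime-divisor coprime (subst (d ℕ.∣_) (abs-* c (+ z)) (Signed.∣⇒∣ᵤ d∣cz))
    where
    d∣ax+by : + d Signed.∣ a ℤ.* + x ℤ.+ b ℤ.* + y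
    d∣ax+by = Signed.∣m∣n⇒∣m+n (Signed.∣m⇒∣m*n {m = a} (+ x) (Signed.∣ᵤ⇒∣ d∣a))
                                (Signed.∣m⇒∣m*n {m = b} (+ y) (Signed.∣ᵤ⇒∣ d∣b))
    d∣cz : + d Signed.∣ c ℤ.* + z
    d∣cz = Signed.∣m+n∣m⇒∣n (subst (+ d Signed.∣_) (sym solves) (Signed.∣ᵤ⇒∣ {i = 0ℤ} (d ∣0))) d∣ax+by

  DivXY : ℕ → Triple → Set
  DivXY d (x , y , z) = (d ℕ.∣ x) × (d ℕ.∣ y)

  DivXY? : ∀ d → Decidable (DivXY d)
  DivXY? d (x , y , z) = (d ∣? x) ×-dec (d ∣? y)

  monochromatic⇒DivXY : ∀ {a b c d t} → + d ∣ a → + d ∣ b → Coprime d ∣ c ∣ → Solves a b c t →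
    T (monochromatic (divisibleBy d) t) → DivXY d t
  monochromatic⇒DivXY {a} {b} {c} {t = x , y , z} d∣a d∣b coprime solves mono
    with fx≡fy , fy≡fz ← Equivalence.to (monochromatic⇔ (divisibleBy _)) mono =
    Equivalence.to divisibleBy-true⇔ (trans fx≡fy fy≡true) , Equivalence.to divisibleBy-true⇔ fy≡true
    where
    fy≡true = trans fy≡fz (Equivalence.from divisibleBy-true⇔ (∣-third-coordinate {a} {b} {c} d∣a d∣b coprime solves))

  -- Shifting interior solutions

  ∣∧<⇒≡0 : ∀ {d m} → d ℕ.∣ m → m < d → m ≡ 0
  ∣∧<⇒≡0 {m = zero}  _   _   = refl
  ∣∧<⇒≡0 {m = suc _} d∣m m<d = contradiction d∣m (>⇒∤ m<d)

  residues-distinct : ∀ {c : ℤ} {d i i′} → 3 ≤ d → Coprime d ∣ c ∣ → i < 3 → i′ < 3 →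
    + d Signed.∣ c ℤ.* (+ i ℤ.- + i′) → i ≡ i′
  residues-distinct {c} {d} {i} {i′} 3≤d coprime i<3 i′<3 d∣c[i-i′] =
    +-injective (ℤP.i-j≡0⇒i≡j (+ i) (+ i′) (ℤP.∣i∣≡0⇒i≡0 (∣∧<⇒≡0 d∣∣i-i′∣ (<-≤-trans ∣i-i′∣<3 3≤d))))
    where
    d∣∣i-i′∣ : d ℕ.∣ ∣ + i ℤ.- + i′ ∣
    d∣∣i-i′∣ = coprime-divisor coprime (subst (d ℕ.∣_) (abs-* c (+ i ℤ.- + i′)) (Signed.∣⇒∣ᵤ d∣c[i-i′]))
    ∣i-i′∣<3 : ∣ + i ℤ.- + i′ ∣ < 3
    ∣i-i′∣<3 = subst (_< 3) (cong ∣_∣ (sym (ℤP.m-n≡m⊖n i i′))) (≤-<-trans (ℤP.∣m⊝n∣≤m⊔n i i′) (⊔-lub i<3 i′<3))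

  Inner : ℕ → ℕ → ℕ → Set
  Inner r n u = r < u × u + r ≤ n

  Inner? : ∀ r n → Decidable (Inner r n)
  Inner? r n u = (r <? u) ×-dec (u + r ≤? n)

  Interior : ℕ → ℕ → Triple → Set
  Interior r n (x , y , z) = Inner r n x × Inner r n y × Inner r n z

  Interior? : ∀ r n → Decidable (Interior r n)
  Interior? r n (x , y , z) = Inner? r n x ×-dec Inner? r n y ×-dec Inner? r n z

  shift : ℤ → ℕ → ℕ
  shift δ u = ∣ + u ℤ.+ δ ∣

  shift-Inner : ∀ {r n u} δ → ∣ δ ∣ ≤ r → Inner r n u → + shift δ u ≡ + u ℤ.+ δ × shift δ u ∈ interval n
  shift-Inner {r} {n} {u} (+ k) k≤r (r<u , u+r≤n) =
    refl , ∈-interval⁺ (≤-trans (≤-<-trans z≤n r<u) (m≤m+n u k)) (≤-trans (+-monoʳ-≤ u k≤r) u+r≤n)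
  shift-Inner {r} {n} {u} -[1+ k ] 1+k≤r (r<u , u+r≤n) =
    subst (λ v → + ∣ v ∣ ≡ v × ∣ v ∣ ∈ interval n) (sym (ℤP.⊖-≥ (<⇒≤ k<u)))
      (refl , ∈-interval⁺ (m<n⇒0<n∸m k<u) (≤-trans (m∸n≤m u (suc k)) (≤-trans (m≤m+n u r) u+r≤n)))
    where
    k<u : suc k < u
    k<u = ≤-<-trans 1+k≤r r<u

  shift-injective : ∀ {δ u u′} → + shift δ u ≡ + u ℤ.+ δ → + shift δ u′ ≡ + u′ ℤ.+ δ →
    shift δ u ≡ shift δ u′ → u ≡ u′
  shift-injective {δ} {u} {u′} lift lift′ e =
    +-injective (ℤ+-cancelʳ δ (+ u) (+ u′) (trans (sym lift) (trans (cong +_ e) lift′)))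

  divisible+small-multiple-injective : ∀ {d} {c : ℤ} {x x′ i i′} → 3 ≤ d → Coprime d ∣ c ∣ →
    i < 3 → i′ < 3 → d ℕ.∣ x → d ℕ.∣ x′ → + x ℤ.+ c ℤ.* + i ≡ + x′ ℤ.+ c ℤ.* + i′ → i ≡ i′ × x ≡ x′
  divisible+small-multiple-injective {d} {c} {x} {x′} {i} {i′} 3≤d coprime i<3 i′<3 d∣x d∣x′ e =
    i≡i′ , +-injective (ℤ+-cancelʳ (c ℤ.* + i) (+ x) (+ x′)
                          (subst (λ k → + x ℤ.+ c ℤ.* + i ≡ + x′ ℤ.+ c ℤ.* + k) (sym i≡i′) e))
    where
    open ≡-Reasoning
    c[i-i′]≡x′-x : c ℤ.* (+ i ℤ.- + i′) ≡ + x′ ℤ.- + x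
    c[i-i′]≡x′-x = begin
      c ℤ.* (+ i ℤ.- + i′)                                          ≡⟨ regroup (+ x) c (+ i) (+ i′) ⟩
      (+ x ℤ.+ c ℤ.* + i) ℤ.- (+ x ℤ.+ c ℤ.* + i′)                  ≡⟨ cong (ℤ._- (+ x ℤ.+ c ℤ.* + i′)) e ⟩
      (+ x′ ℤ.+ c ℤ.* + i′) ℤ.- (+ x ℤ.+ c ℤ.* + i′)                ≡⟨ cancel (+ x′) (+ x) (c ℤ.* + i′) ⟩
      + x′ ℤ.- + x                                                   ∎
      where
      regroup : ∀ x c i i′ → c ℤ.* (i ℤ.- i′) ≡ (x ℤ.+ c ℤ.* i) ℤ.- (x ℤ.+ c ℤ.* i′)
      regroup = solve-∀
      cancel : ∀ x′ x w → (x′ ℤ.+ w) ℤ.- (x ℤ.+ w) ≡ x′ ℤ.- x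
      cancel = solve-∀
    i≡i′ : i ≡ i′
    i≡i′ = residues-distinct {c} 3≤d coprime i<3 i′<3
      (subst (+ d Signed.∣_) (sym c[i-i′]≡x′-x)
        (Signed.∣m∣n⇒∣m-n (Signed.∣ᵤ⇒∣ {i = + x′} d∣x′) (Signed.∣ᵤ⇒∣ {i = + x} d∣x)))

  Solves-+ : ∀ {a b c x y z x′ y′ z′} (δx δy δz : ℤ) →
    + x′ ≡ + x ℤ.+ δx → + y′ ≡ + y ℤ.+ δy → + z′ ≡ + z ℤ.+ δz → a ℤ.* δx ℤ.+ b ℤ.* δy ℤ.+ c ℤ.* δz ≡ 0ℤ →
    Solves a b c (x , y , z) → Solves a b c (x′ , y′ , z′)
  Solves-+ {a} {b} {c} {x} {y} {z} {x′} {y′} {z′} δx δy δz x-lift y-lift z-lift homogeneous solves = begin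
    a ℤ.* + x′ ℤ.+ b ℤ.* + y′ ℤ.+ c ℤ.* + z′
      ≡⟨ cong₂ (λ u v → u ℤ.+ c ℤ.* v) (cong₂ (λ u v → a ℤ.* u ℤ.+ b ℤ.* v) x-lift y-lift) z-lift ⟩
    a ℤ.* (+ x ℤ.+ δx) ℤ.+ b ℤ.* (+ y ℤ.+ δy) ℤ.+ c ℤ.* (+ z ℤ.+ δz)
      ≡⟨ distribute a b c (+ x) (+ y) (+ z) δx δy δz ⟩
    (a ℤ.* + x ℤ.+ b ℤ.* + y ℤ.+ c ℤ.* + z) ℤ.+ (a ℤ.* δx ℤ.+ b ℤ.* δy ℤ.+ c ℤ.* δz)
      ≡⟨ cong₂ ℤ._+_ solves homogeneous ⟩
    0ℤ ∎
    where
    open ≡-Reasoning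
    distribute : ∀ a b c x y z δx δy δz →
      a ℤ.* (x ℤ.+ δx) ℤ.+ b ℤ.* (y ℤ.+ δy) ℤ.+ c ℤ.* (z ℤ.+ δz) ≡
      (a ℤ.* x ℤ.+ b ℤ.* y ℤ.+ c ℤ.* z) ℤ.+ (a ℤ.* δx ℤ.+ b ℤ.* δy ℤ.+ c ℤ.* δz)
    distribute = solve-∀

  coefficientSum : ℤ → ℤ → ℤ → ℕ
  coefficientSum a b c = ∣ a ∣ + ∣ b ∣ + ∣ c ∣

  -- Moves t by i (c, 0, -a) + j (0, c, -b), a solution of the homogeneous equation; through ∣_∣ this is
  -- the true translate only for interior t (shift-Inner).
  shifted : ℤ → ℤ → ℤ → ℕ × ℕ → Triple → Triple
  shifted a b c (i , j) (x , y , z) =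
    shift (c ℤ.* + i) x , shift (c ℤ.* + j) y , shift (ℤ.- (a ℤ.* + i ℤ.+ b ℤ.* + j)) z

  module _ (a b c : ℤ) {i j : ℕ} (i<3 : i < 3) (j<3 : j < 3) where

    private
      S = coefficientSum a b c

      open ≤-Reasoning

      ∣c*i∣≤2S : ∀ {k} → k < 3 → ∣ c ℤ.* + k ∣ ≤ 2 * S
      ∣c*i∣≤2S {k} k<3 = begin
        ∣ c ℤ.* + k ∣  ≡⟨ abs-* c (+ k) ⟩
        ∣ c ∣ * k      ≤⟨ *-monoʳ-≤ ∣ c ∣ (s≤s⁻¹ k<3) ⟩
        ∣ c ∣ * 2      ≡⟨ *-comm ∣ c ∣ 2 ⟩
        2 * ∣ c ∣      ≤⟨ *-monoʳ-≤ 2 (m≤n+m ∣ c ∣ (∣ a ∣ + ∣ b ∣)) ⟩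
        2 * S          ∎

      ∣ai+bj∣≤2S : ∣ ℤ.- (a ℤ.* + i ℤ.+ b ℤ.* + j) ∣ ≤ 2 * S
      ∣ai+bj∣≤2S = begin
        ∣ ℤ.- (a ℤ.* + i ℤ.+ b ℤ.* + j) ∣  ≡⟨ ℤP.∣-i∣≡∣i∣ (a ℤ.* + i ℤ.+ b ℤ.* + j) ⟩
        ∣ a ℤ.* + i ℤ.+ b ℤ.* + j ∣        ≤⟨ ℤP.∣i+j∣≤∣i∣+∣j∣ (a ℤ.* + i) (b ℤ.* + j) ⟩
        ∣ a ℤ.* + i ∣ + ∣ b ℤ.* + j ∣      ≡⟨ cong₂ _+_ (abs-* a (+ i)) (abs-* b (+ j)) ⟩
        ∣ a ∣ * i + ∣ b ∣ * j              ≤⟨ +-mono-≤ (*-monoʳ-≤ ∣ a ∣ (s≤s⁻¹ i<3)) (*-monoʳ-≤ ∣ b ∣ (s≤s⁻¹ j<3)) ⟩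
        ∣ a ∣ * 2 + ∣ b ∣ * 2              ≡⟨ factor-2 ∣ a ∣ ∣ b ∣ ⟩
        2 * (∣ a ∣ + ∣ b ∣)                ≤⟨ *-monoʳ-≤ 2 (m≤m+n (∣ a ∣ + ∣ b ∣) ∣ c ∣) ⟩
        2 * S                              ∎
        where
        factor-2 : ∀ m n → m * 2 + n * 2 ≡ 2 * (m + n)
        factor-2 = ℕ-Solver.solve-∀

    shifted-Interior : ∀ {n x y z} → Interior (2 * coefficientSum a b c) n (x , y , z) →
      let (x′ , y′ , z′) = shifted a b c (i , j) (x , y , z) in
      ((+ x′ ≡ + x ℤ.+ c ℤ.* + i) × (+ y′ ≡ + y ℤ.+ c ℤ.* + j) × (+ z′ ≡ + z ℤ.+ ℤ.- (a ℤ.* + i ℤ.+ b ℤ.* + j)))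
      × InBox n (x′ , y′ , z′)
    shifted-Interior (x-inner , y-inner , z-inner) =
      let x-lift , x∈ = shift-Inner (c ℤ.* + i) (∣c*i∣≤2S i<3) x-inner
          y-lift , y∈ = shift-Inner (c ℤ.* + j) (∣c*i∣≤2S j<3) y-inner
          z-lift , z∈ = shift-Inner (ℤ.- (a ℤ.* + i ℤ.+ b ℤ.* + j)) ∣ai+bj∣≤2S z-inner
      in (x-lift , y-lift , z-lift) , (x∈ , y∈ , z∈)

    shifted-∈-solutions : ∀ {n t} → t ∈ solutions a b c n → Interior (2 * coefficientSum a b c) n t →
      shifted a b c (i , j) t ∈ solutions a b c n
    shifted-∈-solutions {n} {x , y , z} t∈ interior =
      let (x-lift , y-lift , z-lift) , box = shifted-Interior interior in
      ∈-solutions⁺ {a} {b} {c} box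
        (Solves-+ {a} {b} {c} (c ℤ.* + i) (c ℤ.* + j) (ℤ.- (a ℤ.* + i ℤ.+ b ℤ.* + j)) x-lift y-lift z-lift
          (homogeneous a b c (+ i) (+ j)) (proj₂ (∈-solutions⁻ {a} {b} {c} {n} t∈)))
      where
      homogeneous : ∀ a b c i j →
        a ℤ.* (c ℤ.* i) ℤ.+ b ℤ.* (c ℤ.* j) ℤ.+ c ℤ.* (ℤ.- (a ℤ.* i ℤ.+ b ℤ.* j)) ≡ 0ℤ
      homogeneous = solve-∀

  shifted-injective : ∀ {a b c d n i j i′ j′ s s′} → 3 ≤ d → Coprime d ∣ c ∣ →
    i < 3 → j < 3 → i′ < 3 → j′ < 3 → DivXY d s → DivXY d s′ →
    Interior (2 * coefficientSum a b c) n s → Interior (2 * coefficientSum a b c) n s′ →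
    shifted a b c (i , j) s ≡ shifted a b c (i′ , j′) s′ → ((i , j) , s) ≡ ((i′ , j′) , s′)
  shifted-injective {a} {b} {c} {i = i} {j} {i′} {j′} {x , y , z} {x′ , y′ , z′} 3≤d coprime i<3 j<3 i′<3 j′<3
    (d∣x , d∣y) (d∣x′ , d∣y′) interior interior′ e =
    cong₂ _,_ (cong₂ _,_ i≡i′ j≡j′) (cong₂ _,_ x≡x′ (cong₂ _,_ y≡y′ z≡z′))
    where
    lifts = proj₁ (shifted-Interior a b c i<3 j<3 interior)
    lifts′ = proj₁ (shifted-Interior a b c i′<3 j′<3 interior′)
    i≡i′×x≡x′ = divisible+small-multiple-injective {c = c} 3≤d coprime i<3 i′<3 d∣x d∣x′
      (trans (sym (proj₁ lifts)) (trans (cong (λ t → + proj₁ t) e) (proj₁ lifts′)))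
    j≡j′×y≡y′ = divisible+small-multiple-injective {c = c} 3≤d coprime j<3 j′<3 d∣y d∣y′
      (trans (sym (proj₁ (proj₂ lifts))) (trans (cong (λ t → + proj₁ (proj₂ t)) e) (proj₁ (proj₂ lifts′))))
    i≡i′ = proj₁ i≡i′×x≡x′
    x≡x′ = proj₂ i≡i′×x≡x′
    j≡j′ = proj₁ j≡j′×y≡y′
    y≡y′ = proj₂ j≡j′×y≡y′
    δ : ℕ → ℕ → ℤ
    δ k l = ℤ.- (a ℤ.* + k ℤ.+ b ℤ.* + l)
    z≡z′ : z ≡ z′
    z≡z′ = shift-injective {δ i j} (proj₂ (proj₂ lifts))
      (subst₂ (λ k l → + shift (δ k l) z′ ≡ + z′ ℤ.+ δ k l) (sym i≡i′) (sym j≡j′) (proj₂ (proj₂ lifts′)))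
      (trans (cong (λ t → proj₂ (proj₂ t)) e) (cong₂ (λ k l → shift (δ k l) z′) (sym i≡i′) (sym j≡j′)))

  InteriorMultiple : ℕ → ℕ → ℕ → Triple → Set
  InteriorMultiple d r n t = DivXY d t × Interior r n t

  InteriorMultiple? : ∀ d r n → Decidable (InteriorMultiple d r n)
  InteriorMultiple? d r n t = DivXY? d t ×-dec Interior? r n t

  9*interior≤countT : ∀ a b c {d} → 3 ≤ d → Coprime d ∣ c ∣ → ∀ n →
    9 * length (filter (InteriorMultiple? d (2 * coefficientSum a b c) n) (solutions a b c n)) ≤ countT a b c n
  9*interior≤countT a b c {d} 3≤d coprime n =
    subst (_≤ countT a b c n) (length-cartesianProduct steps interior)
      (length-≤-injection (λ p → shifted a b c (proj₁ p) (proj₂ p)) (solutions a b c n)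
        (Unique.cartesianProduct⁺ (Unique.cartesianProduct⁺ (Unique.upTo⁺ 3) (Unique.upTo⁺ 3))
          (Unique.filter⁺ interior? (solutions-unique a b c n)))
        into injective)
    where
    R = 2 * coefficientSum a b c
    interior? = InteriorMultiple? d R n
    interior = filter interior? (solutions a b c n)
    steps = cartesianProduct (upTo 3) (upTo 3)

    unpack : ∀ {i j t} → ((i , j) , t) ∈ cartesianProduct steps interior →
      (i < 3 × j < 3) × t ∈ solutions a b c n × InteriorMultiple d R n t
    unpack p∈ =
      let ij∈ , t∈ = ∈-cartesianProduct⁻ steps interior p∈
          i∈ , j∈ = ∈-cartesianProduct⁻ (upTo 3) (upTo 3) ij∈
          t∈sol , multiple = ∈-filter⁻ interior? {xs = solutions a b c n} t∈
      in (∈-upTo⁻ i∈ , ∈-upTo⁻ j∈) , t∈sol , multiple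

    into : ∀ {p} → p ∈ cartesianProduct steps interior → shifted a b c (proj₁ p) (proj₂ p) ∈ solutions a b c n
    into {(i , j) , t} p∈ =
      let (i<3 , j<3) , t∈ , _ , inner = unpack p∈ in shifted-∈-solutions a b c i<3 j<3 t∈ inner

    injective : ∀ {p q} → p ∈ cartesianProduct steps interior → q ∈ cartesianProduct steps interior →
      shifted a b c (proj₁ p) (proj₂ p) ≡ shifted a b c (proj₁ q) (proj₂ q) → p ≡ q
    injective {(i , j) , s} {(i′ , j′) , s′} p∈ q∈ =
      let (i<3 , j<3) , _ , divXY , inner = unpack p∈
          (i′<3 , j′<3) , _ , divXY′ , inner′ = unpack q∈
      in shifted-injective {a} {b} {c} 3≤d coprime i<3 j<3 i′<3 j′<3 divXY divXY′ inner inner′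

  -- Solutions near the boundary

  coord : Fin 3 → Triple → ℕ
  coord zero             (x , _ , _) = x
  coord (suc zero)       (_ , y , _) = y
  coord (suc (suc zero)) (_ , _ , z) = z

  coord-InBox : ∀ k {n t} → InBox n t → coord k t ∈ interval n
  coord-InBox zero             (x∈ , _ , _) = x∈
  coord-InBox (suc zero)       (_ , y∈ , _) = y∈
  coord-InBox (suc (suc zero)) (_ , _ , z∈) = z∈

  Solves-xy-injective : ∀ {a b c s s′} → c ≢ 0ℤ → Solves a b c s → Solves a b c s′ →
    coord zero s ≡ coord zero s′ → coord (suc zero) s ≡ coord (suc zero) s′ → s ≡ s′
  Solves-xy-injective {a} {b} {c} {x , y , z} {.x , .y , z′} c≢0 solves solves′ refl refl =
    cong (λ w → x , y , w) (+-injective (ℤP.*-cancelˡ-≡ c (+ z) (+ z′) {{ℤ.≢-nonZero c≢0}}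
      (ℤ+-cancelˡ (a ℤ.* + x ℤ.+ b ℤ.* + y) (c ℤ.* + z) (c ℤ.* + z′) (trans solves (sym solves′)))))

  Solves-xz-injective : ∀ {a b c s s′} → b ≢ 0ℤ → Solves a b c s → Solves a b c s′ →
    coord zero s ≡ coord zero s′ → coord (suc (suc zero)) s ≡ coord (suc (suc zero)) s′ → s ≡ s′
  Solves-xz-injective {a} {b} {c} {x , y , z} {.x , y′ , .z} b≢0 solves solves′ refl refl =
    cong (λ w → x , w , z) (+-injective (ℤP.*-cancelˡ-≡ b (+ y) (+ y′) {{ℤ.≢-nonZero b≢0}}
      (ℤ+-cancelˡ (a ℤ.* + x) (b ℤ.* + y) (b ℤ.* + y′)
        (ℤ+-cancelʳ (c ℤ.* + z) _ _ (trans solves (sym solves′))))))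

  Edge : ℕ → ℕ → ℕ → Set
  Edge r n u = u ≤ r ⊎ n < u + r

  Edge? : ∀ r n → Decidable (Edge r n)
  Edge? r n u = (u ≤? r) ⊎-dec (n <? u + r)

  ¬Inner⇒Edge : ∀ {r n u} → ¬ Inner r n u → Edge r n u
  ¬Inner⇒Edge {r} {n} {u} ¬inner with r <? u | u + r ≤? n
  ... | no  r≮u | _          = inj₁ (≮⇒≥ r≮u)
  ... | yes _   | no u+r≰n   = inj₂ (≰⇒> u+r≰n)
  ... | yes r<u | yes u+r≤n  = contradiction (r<u , u+r≤n) ¬inner

  ¬Interior⇒Edge : ∀ {r n} t → ¬ Interior r n t →
    Edge r n (coord zero t) ⊎ Edge r n (coord (suc zero) t) ⊎ Edge r n (coord (suc (suc zero)) t)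
  ¬Interior⇒Edge {r} {n} (x , y , z) ¬interior with Inner? r n x | Inner? r n y
  ... | no ¬x-inner     | _               = inj₁ (¬Inner⇒Edge ¬x-inner)
  ... | yes _           | no ¬y-inner     = inj₂ (inj₁ (¬Inner⇒Edge ¬y-inner))
  ... | yes x-inner     | yes y-inner     =
    inj₂ (inj₂ (¬Inner⇒Edge (λ z-inner → ¬interior (x-inner , y-inner , z-inner))))

  module _ (a b c : ℤ) (n r : ℕ) (k k′ : Fin 3)
           (determined : ∀ {s s′} → Solves a b c s → Solves a b c s′ →
                         coord k s ≡ coord k s′ → coord k′ s ≡ coord k′ s′ → s ≡ s′) where

    strip-bound : ∀ {P : ℕ → Set} (P? : Decidable P) (κ : ℕ → ℕ) →
      (∀ {u} → u ∈ interval n → P u → κ u ∈ interval r) → (∀ {u u′} → P u → P u′ → κ u ≡ κ u′ → u ≡ u′) →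
      length (filter (λ s → P? (coord k s)) (solutions a b c n)) ≤ r * n
    strip-bound {P} P? κ κ-into κ-injective =
      subst (length strip ≤_) (trans (length-cartesianProduct (interval r) (interval n))
                                     (cong₂ _*_ (length-interval r) (length-interval n)))
        (length-≤-injection (λ s → κ (coord k s) , coord k′ s) (cartesianProduct (interval r) (interval n))
          (Unique.filter⁺ strip? (solutions-unique a b c n)) into injective)
      where
      strip? = λ s → P? (coord k s)
      strip = filter strip? (solutions a b c n)
      unpack : ∀ {s} → s ∈ strip → InBox n s × Solves a b c s × P (coord k s)
      unpack s∈ = let s∈sol , Pks = ∈-filter⁻ strip? {xs = solutions a b c n} s∈ in
                  proj₁ (∈-solutions⁻ {a} {b} {c} {n} s∈sol) , proj₂ (∈-solutions⁻ {a} {b} {c} {n} s∈sol) , Pks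
      into : ∀ {s} → s ∈ strip → (κ (coord k s) , coord k′ s) ∈ cartesianProduct (interval r) (interval n)
      into s∈ = let box , _ , Pks = unpack s∈ in
                ∈-cartesianProduct⁺ (κ-into (coord-InBox k box) Pks) (coord-InBox k′ box)
      injective : ∀ {s s′} → s ∈ strip → s′ ∈ strip →
        (κ (coord k s) , coord k′ s) ≡ (κ (coord k s′) , coord k′ s′) → s ≡ s′
      injective s∈ s′∈ e = let _ , solves , Pks = unpack s∈ ; _ , solves′ , Pks′ = unpack s′∈ in
        determined solves solves′ (κ-injective Pks Pks′ (cong proj₁ e)) (cong proj₂ e)

    low-strip-bound : length (filter (λ s → coord k s ≤? r) (solutions a b c n)) ≤ r * n
    low-strip-bound = strip-bound (_≤? r) (λ u → u) (λ u∈ u≤r → ∈-interval⁺ (proj₁ (∈-interval⁻ u∈)) u≤r) (λ _ _ e → e)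

    high-strip-bound : length (filter (λ s → n <? coord k s + r) (solutions a b c n)) ≤ r * n
    high-strip-bound = strip-bound (λ u → n <? u + r) (λ u → u + r ∸ n)
      (λ {u} u∈ n<u+r → ∈-interval⁺ (m<n⇒0<n∸m n<u+r)
         (subst (u + r ∸ n ≤_) (m+n∸m≡n n r) (∸-monoˡ-≤ n (+-monoˡ-≤ r (proj₂ (∈-interval⁻ u∈))))))
      (λ {u} {u′} n<u+r n<u′+r e → +-cancelʳ-≡ r u u′
         (trans (sym (m∸n+n≡m (<⇒≤ n<u+r))) (trans (cong (_+ n) e) (m∸n+n≡m (<⇒≤ n<u′+r)))))

    edge-strip-bound : length (filter (λ s → Edge? r n (coord k s)) (solutions a b c n)) ≤ r * n + r * n
    edge-strip-bound = ≤-trans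
      (length-filter-⊎ (λ s → Edge? r n (coord k s)) (λ s → coord k s ≤? r) (λ s → n <? coord k s + r)
        (solutions a b c n) (λ _ edge → edge))
      (+-mono-≤ low-strip-bound high-strip-bound)

  boundary-bound : ∀ a b c r n → b ≢ 0ℤ → c ≢ 0ℤ →
    length (filter (λ t → ¬? (Interior? r n t)) (solutions a b c n)) ≤ 6 * (r * n)
  boundary-bound a b c r n b≢0 c≢0 = begin
    length (filter (λ t → ¬? (Interior? r n t)) sols)
      ≤⟨ length-filter-⊎ (λ t → ¬? (Interior? r n t)) edgeˣ? edgeʸᶻ? sols (λ {t} _ → ¬Interior⇒Edge t) ⟩
    length (filter edgeˣ? sols) + length (filter edgeʸᶻ? sols)
      ≤⟨ +-monoʳ-≤ _ (length-filter-⊎ edgeʸᶻ? edgeʸ? edgeᶻ? sols (λ _ edge → edge)) ⟩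
    length (filter edgeˣ? sols) + (length (filter edgeʸ? sols) + length (filter edgeᶻ? sols))
      ≤⟨ +-mono-≤ (edge-strip-bound a b c n r zero (suc zero) (Solves-xy-injective {a} {b} c≢0))
           (+-mono-≤ (edge-strip-bound a b c n r (suc zero) zero
                        (λ solves solves′ ey ex → Solves-xy-injective {a} {b} c≢0 solves solves′ ex ey))
                     (edge-strip-bound a b c n r (suc (suc zero)) zero
                        (λ solves solves′ ez ex → Solves-xz-injective {a} {b} {c} b≢0 solves solves′ ex ez))) ⟩
    (r * n + r * n) + ((r * n + r * n) + (r * n + r * n))       ≡⟨ six (r * n) ⟩
    6 * (r * n)                                                  ∎
    where
    open ≤-Reasoning
    sols = solutions a b c n
    edgeˣ? = λ t → Edge? r n (coord zero t)
    edgeʸ? = λ t → Edge? r n (coord (suc zero) t)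
    edgeᶻ? = λ t → Edge? r n (coord (suc (suc zero)) t)
    edgeʸᶻ? = λ t → edgeʸ? t ⊎-dec edgeᶻ? t
    six : ∀ m → (m + m) + ((m + m) + (m + m)) ≡ 6 * m
    six = ℕ-Solver.solve-∀

  -- Quadratically many solutions divisible by d

  DivAll : ℕ → Triple → Set
  DivAll d (x , y , z) = (d ℕ.∣ x) × (d ℕ.∣ y) × (d ℕ.∣ z)

  DivAll? : ∀ d → Decidable (DivAll d)
  DivAll? d (x , y , z) = (d ∣? x) ×-dec (d ∣? y) ×-dec (d ∣? z)

  ManyMultipleSolutions : ℤ → ℤ → ℤ → ℕ → Set
  ManyMultipleSolutions a b c d = ∀ n t → t * (d * coefficientSum a b c) ≤ n →
    t * t ≤ length (filter (DivAll? d) (solutions a b c n))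

  -- Holds exactly when a and c have opposite signs (or one of them is 0).
  Opposite : ℤ → ℤ → Set
  Opposite a c = a ℤ.* + ∣ c ∣ ℤ.+ c ℤ.* + ∣ a ∣ ≡ 0ℤ

  0<∣i∣ : ∀ {i : ℤ} → i ≢ 0ℤ → 0 < ∣ i ∣
  0<∣i∣ i≢0 = n≢0⇒n>0 (λ ∣i∣≡0 → i≢0 (ℤP.∣i∣≡0⇒i≡0 ∣i∣≡0))

  scaledFamily : ℤ → ℤ → ℤ → ℕ → ℕ × ℕ → Triple
  scaledFamily a b c d (i , j) = i * (d * ∣ c ∣) , j * (d * ∣ c ∣) , i * (d * ∣ a ∣) + j * (d * ∣ b ∣)

  scaledFamily-Solves : ∀ {a b c} d i j → Opposite a c → Opposite b c → Solves a b c (scaledFamily a b c d (i , j))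
  scaledFamily-Solves {a} {b} {c} d i j opposite-ac opposite-bc = begin
    a ℤ.* + (i * (d * C)) ℤ.+ b ℤ.* + (j * (d * C)) ℤ.+ c ℤ.* + (i * (d * A) + j * (d * B))
      ≡⟨ cong₂ (λ u v → u ℤ.+ c ℤ.* v) (cong₂ (λ u v → a ℤ.* u ℤ.+ b ℤ.* v) (pos-*³ i d C) (pos-*³ j d C))
               (trans (ℤP.pos-+ (i * (d * A)) (j * (d * B))) (cong₂ ℤ._+_ (pos-*³ i d A) (pos-*³ j d B))) ⟩
    a ℤ.* (+ i ℤ.* (+ d ℤ.* + C)) ℤ.+ b ℤ.* (+ j ℤ.* (+ d ℤ.* + C)) ℤ.+ c ℤ.* (+ i ℤ.* (+ d ℤ.* + A) ℤ.+ + j ℤ.* (+ d ℤ.* + B))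
      ≡⟨ regroup a b c (+ i) (+ j) (+ d) (+ A) (+ B) (+ C) ⟩
    + i ℤ.* + d ℤ.* (a ℤ.* + C ℤ.+ c ℤ.* + A) ℤ.+ + j ℤ.* + d ℤ.* (b ℤ.* + C ℤ.+ c ℤ.* + B)
      ≡⟨ cong₂ (λ u v → + i ℤ.* + d ℤ.* u ℤ.+ + j ℤ.* + d ℤ.* v) opposite-ac opposite-bc ⟩
    + i ℤ.* + d ℤ.* 0ℤ ℤ.+ + j ℤ.* + d ℤ.* 0ℤ
      ≡⟨ annihilate (+ i ℤ.* + d) (+ j ℤ.* + d) ⟩
    0ℤ ∎
    where
    open ≡-Reasoning
    A = ∣ a ∣
    B = ∣ b ∣
    C = ∣ c ∣
    pos-*³ : ∀ i d e → + (i * (d * e)) ≡ + i ℤ.* (+ d ℤ.* + e)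
    pos-*³ i d e = trans (ℤP.pos-* i (d * e)) (cong (+ i ℤ.*_) (ℤP.pos-* d e))
    regroup : ∀ a b c i j d A B C →
      a ℤ.* (i ℤ.* (d ℤ.* C)) ℤ.+ b ℤ.* (j ℤ.* (d ℤ.* C)) ℤ.+ c ℤ.* (i ℤ.* (d ℤ.* A) ℤ.+ j ℤ.* (d ℤ.* B))
      ≡ i ℤ.* d ℤ.* (a ℤ.* C ℤ.+ c ℤ.* A) ℤ.+ j ℤ.* d ℤ.* (b ℤ.* C ℤ.+ c ℤ.* B)
    regroup = solve-∀
    annihilate : ∀ u v → u ℤ.* 0ℤ ℤ.+ v ℤ.* 0ℤ ≡ 0ℤ
    annihilate = solve-∀

  scaledFamily-DivAll : ∀ a b c d i j → DivAll d (scaledFamily a b c d (i , j))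
  scaledFamily-DivAll a b c d i j =
    ∣n⇒∣m*n i (m∣m*n ∣ c ∣) , ∣n⇒∣m*n j (m∣m*n ∣ c ∣) , ∣m∣n⇒∣m+n (∣n⇒∣m*n i (m∣m*n ∣ a ∣)) (∣n⇒∣m*n j (m∣m*n ∣ b ∣))

  scaledFamily-InBox : ∀ {a b c d n t i j} → 0 < d → a ≢ 0ℤ → c ≢ 0ℤ → t * (d * coefficientSum a b c) ≤ n →
    i ∈ interval t → j ∈ interval t → InBox n (scaledFamily a b c d (i , j))
  scaledFamily-InBox {a} {b} {c} {d} {n} {t} {i} {j} 0<d a≢0 c≢0 tdS≤n i∈ j∈ =
    scaled∈ i∈ , scaled∈ j∈ , ∈-interval⁺ (≤-trans (*-mono-≤ 0<i (*-mono-≤ 0<d (0<∣i∣ a≢0))) (m≤m+n _ _)) z≤n′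
    where
    A = ∣ a ∣
    B = ∣ b ∣
    C = ∣ c ∣
    0<i = proj₁ (∈-interval⁻ i∈)
    C≤S : C ≤ coefficientSum a b c
    C≤S = m≤n+m C (A + B)
    scaled∈ : ∀ {k} → k ∈ interval t → k * (d * C) ∈ interval n
    scaled∈ k∈ = let 0<k , k≤t = ∈-interval⁻ k∈ in
      ∈-interval⁺ (*-mono-≤ 0<k (*-mono-≤ 0<d (0<∣i∣ c≢0))) (≤-trans (*-mono-≤ k≤t (*-monoʳ-≤ d C≤S)) tdS≤n)
    z≤n′ : i * (d * A) + j * (d * B) ≤ n
    z≤n′ = begin
      i * (d * A) + j * (d * B)       ≤⟨ +-mono-≤ (*-monoˡ-≤ (d * A) (proj₂ (∈-interval⁻ i∈)))
                                                  (*-monoˡ-≤ (d * B) (proj₂ (∈-interval⁻ j∈))) ⟩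
      t * (d * A) + t * (d * B)       ≡⟨ factor t d A B ⟩
      t * (d * (A + B))               ≤⟨ *-monoʳ-≤ t (*-monoʳ-≤ d (m≤m+n (A + B) C)) ⟩
      t * (d * coefficientSum a b c)  ≤⟨ tdS≤n ⟩
      n                               ∎
      where
      open ≤-Reasoning
      factor : ∀ t d A B → t * (d * A) + t * (d * B) ≡ t * (d * (A + B))
      factor = ℕ-Solver.solve-∀

  opposite⇒ManyMultipleSolutions : ∀ {a b c d} → 0 < d → a ≢ 0ℤ → c ≢ 0ℤ →
    Opposite a c → Opposite b c → ManyMultipleSolutions a b c d
  opposite⇒ManyMultipleSolutions {a} {b} {c} {d} 0<d a≢0 c≢0 opposite-ac opposite-bc n t tdS≤n =
    subst (_≤ length multiples) (trans (length-cartesianProduct (interval t) (interval t))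
                                        (cong₂ _*_ (length-interval t) (length-interval t)))
      (length-≤-injection (scaledFamily a b c d) multiples
        (Unique.cartesianProduct⁺ (interval-unique t) (interval-unique t)) into injective)
    where
    multiples = filter (DivAll? d) (solutions a b c n)
    into : ∀ {p} → p ∈ cartesianProduct (interval t) (interval t) → scaledFamily a b c d p ∈ multiples
    into {i , j} p∈ = let i∈ , j∈ = ∈-cartesianProduct⁻ (interval t) (interval t) p∈ in
      ∈-filter⁺ (DivAll? d)
        (∈-solutions⁺ {a} {b} {c} (scaledFamily-InBox {a} {b} {c} 0<d a≢0 c≢0 tdS≤n i∈ j∈)
          (scaledFamily-Solves {a} {b} {c} d i j opposite-ac opposite-bc))
        (scaledFamily-DivAll a b c d i j)
    injective : ∀ {p q} → p ∈ cartesianProduct (interval t) (interval t) → q ∈ cartesianProduct (interval t) (interval t) →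
      scaledFamily a b c d p ≡ scaledFamily a b c d q → p ≡ q
    injective {i , j} {i′ , j′} _ _ e = cong₂ _,_
      (*-cancelʳ-≡ i i′ (d * ∣ c ∣) {{dC≢0}} (cong proj₁ e))
      (*-cancelʳ-≡ j j′ (d * ∣ c ∣) {{dC≢0}} (cong (λ s → proj₁ (proj₂ s)) e))
      where
      dC≢0 = >-nonZero (*-mono-≤ 0<d (0<∣i∣ c≢0))

  ManyMultipleSolutions-swap₂₃ : ∀ a b c {d} → ManyMultipleSolutions a c b d → ManyMultipleSolutions a b c d
  ManyMultipleSolutions-swap₂₃ a b c {d} many n t tdS≤n = ≤-trans
    (many n t (subst (λ S → t * (d * S) ≤ n) (reorder (∣ a ∣) (∣ b ∣) (∣ c ∣)) tdS≤n))
    (Transport₂₃.length-filter-solutions-≤ a c b (DivAll? d) (DivAll? d) (λ (d∣x , d∣y , d∣z) → d∣x , d∣z , d∣y) n)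
    where
    reorder : ∀ x y z → x + y + z ≡ x + z + y
    reorder = ℕ-Solver.solve-∀

  ManyMultipleSolutions-swap₁₃ : ∀ a b c {d} → ManyMultipleSolutions c b a d → ManyMultipleSolutions a b c d
  ManyMultipleSolutions-swap₁₃ a b c {d} many n t tdS≤n = ≤-trans
    (many n t (subst (λ S → t * (d * S) ≤ n) (reorder (∣ a ∣) (∣ b ∣) (∣ c ∣)) tdS≤n))
    (Transport₁₃.length-filter-solutions-≤ c b a (DivAll? d) (DivAll? d) (λ (d∣x , d∣y , d∣z) → d∣z , d∣y , d∣x) n)
    where
    reorder : ∀ x y z → x + y + z ≡ z + y + x
    reorder = ℕ-Solver.solve-∀

  opposite-+- : ∀ p q → Opposite +[1+ p ] -[1+ q ]
  opposite-+- p q = cancel +[1+ p ] +[1+ q ]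
    where
    cancel : ∀ x y → x ℤ.* y ℤ.+ (ℤ.- y) ℤ.* x ≡ 0ℤ
    cancel = solve-∀

  opposite-−+ : ∀ p q → Opposite -[1+ p ] +[1+ q ]
  opposite-−+ p q = cancel +[1+ p ] +[1+ q ]
    where
    cancel : ∀ x y → (ℤ.- x) ℤ.* y ℤ.+ y ℤ.* x ≡ 0ℤ
    cancel = solve-∀

  mixed-signs⇒ManyMultipleSolutions : ∀ {a b c d} → 0 < d → a ≢ 0ℤ → b ≢ 0ℤ → c ≢ 0ℤ →
    ¬ (0ℤ ℤ.< a × 0ℤ ℤ.< b × 0ℤ ℤ.< c) → ¬ (a ℤ.< 0ℤ × b ℤ.< 0ℤ × c ℤ.< 0ℤ) → ManyMultipleSolutions a b c d
  mixed-signs⇒ManyMultipleSolutions { +0 }       { _ }        { _ }        _ a≢0 _ _ _ _ = contradiction refl a≢0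
  mixed-signs⇒ManyMultipleSolutions { _ }        { +0 }       { _ }        _ _ b≢0 _ _ _ = contradiction refl b≢0
  mixed-signs⇒ManyMultipleSolutions { _ }        { _ }        { +0 }       _ _ _ c≢0 _ _ = contradiction refl c≢0
  mixed-signs⇒ManyMultipleSolutions { +[1+ _ ] } { +[1+ _ ] } { +[1+ _ ] } _ _ _ _ ¬positive _ =
    contradiction (ℤ.+<+ z<s , ℤ.+<+ z<s , ℤ.+<+ z<s) ¬positive
  mixed-signs⇒ManyMultipleSolutions { -[1+ _ ] } { -[1+ _ ] } { -[1+ _ ] } _ _ _ _ _ ¬negative =
    contradiction (ℤ.-<+ , ℤ.-<+ , ℤ.-<+) ¬negative
  mixed-signs⇒ManyMultipleSolutions { +[1+ p ] } { +[1+ q ] } { -[1+ r ] } 0<d a≢0 b≢0 c≢0 _ _ =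
    opposite⇒ManyMultipleSolutions {b = +[1+ q ]} 0<d a≢0 c≢0 (opposite-+- p r) (opposite-+- q r)
  mixed-signs⇒ManyMultipleSolutions { -[1+ p ] } { -[1+ q ] } { +[1+ r ] } 0<d a≢0 b≢0 c≢0 _ _ =
    opposite⇒ManyMultipleSolutions {b = -[1+ q ]} 0<d a≢0 c≢0 (opposite-−+ p r) (opposite-−+ q r)
  mixed-signs⇒ManyMultipleSolutions { +[1+ p ] } { -[1+ q ] } { +[1+ r ] } 0<d a≢0 b≢0 c≢0 _ _ =
    ManyMultipleSolutions-swap₂₃ +[1+ p ] -[1+ q ] +[1+ r ]
      (opposite⇒ManyMultipleSolutions {b = +[1+ r ]} 0<d a≢0 b≢0 (opposite-+- p q) (opposite-+- r q))
  mixed-signs⇒ManyMultipleSolutions { -[1+ p ] } { +[1+ q ] } { -[1+ r ] } 0<d a≢0 b≢0 c≢0 _ _ =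
    ManyMultipleSolutions-swap₂₃ -[1+ p ] +[1+ q ] -[1+ r ]
      (opposite⇒ManyMultipleSolutions {b = -[1+ r ]} 0<d a≢0 b≢0 (opposite-−+ p q) (opposite-−+ r q))
  mixed-signs⇒ManyMultipleSolutions { -[1+ p ] } { +[1+ q ] } { +[1+ r ] } 0<d a≢0 b≢0 c≢0 _ _ =
    ManyMultipleSolutions-swap₁₃ -[1+ p ] +[1+ q ] +[1+ r ]
      (opposite⇒ManyMultipleSolutions {b = +[1+ q ]} 0<d c≢0 a≢0 (opposite-+- r p) (opposite-+- q p))
  mixed-signs⇒ManyMultipleSolutions { +[1+ p ] } { -[1+ q ] } { -[1+ r ] } 0<d a≢0 b≢0 c≢0 _ _ =
    ManyMultipleSolutions-swap₁₃ +[1+ p ] -[1+ q ] -[1+ r ]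
      (opposite⇒ManyMultipleSolutions {b = -[1+ q ]} 0<d c≢0 a≢0 (opposite-−+ r p) (opposite-−+ q p))

  density-arithmetic : ∀ {M A I B T} → M ≤ A → A ≤ I + B → 9 * I ≤ T → 9 * B ≤ A → 4 * 8 * M + 4 * T ≤ 8 * T
  density-arithmetic {M} {A} {I} {B} {T} M≤A A≤I+B 9I≤T 9B≤A = begin
    4 * 8 * M + 4 * T              ≤⟨ +-monoˡ-≤ (4 * T) (*-monoʳ-≤ (4 * 8) (≤-trans M≤A A≤I+B)) ⟩
    4 * 8 * (I + B) + 4 * T        ≡⟨ cong (_+ 4 * T) (expand I B) ⟩
    4 * (8 * I + 8 * B) + 4 * T    ≤⟨ +-monoˡ-≤ (4 * T) (*-monoʳ-≤ 4 (+-monoʳ-≤ (8 * I) 8B≤I)) ⟩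
    4 * (8 * I + I) + 4 * T        ≡⟨ cong (λ m → 4 * m + 4 * T) (+-comm (8 * I) I) ⟩
    4 * (9 * I) + 4 * T            ≤⟨ +-monoˡ-≤ (4 * T) (*-monoʳ-≤ 4 9I≤T) ⟩
    4 * T + 4 * T                  ≡⟨ double T ⟩
    8 * T                          ∎
    where
    open ≤-Reasoning
    expand : ∀ I B → 4 * 8 * (I + B) ≡ 4 * (8 * I + 8 * B)
    expand = ℕ-Solver.solve-∀
    double : ∀ T → 4 * T + 4 * T ≡ 8 * T
    double = ℕ-Solver.solve-∀
    8B≤I : 8 * B ≤ I
    8B≤I = +-cancelʳ-≤ B (8 * B) I (subst (_≤ I + B) (+-comm B (8 * B)) (≤-trans 9B≤A A≤I+B))

  quotient-bounds : ∀ W K n .{{_ : NonZero W}} → 0 < K → K * W ≤ n →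
    K ≤ n / W × (n / W) * W ≤ n × n ≤ 2 * ((n / W) * W)
  quotient-bounds W K n 0<K KW≤n = K≤t , m/n*n≤m n W , n≤2tW
    where
    t = n / W
    K≤t : K ≤ t
    K≤t = subst (_≤ t) (m*n/n≡m K W) (/-monoˡ-≤ W KW≤n)
    W≤tW : W ≤ t * W
    W≤tW = subst (_≤ t * W) (*-identityˡ W) (*-monoˡ-≤ W (≤-trans 0<K K≤t))
    n≤2tW : n ≤ 2 * (t * W)
    n≤2tW = begin
      n              ≡⟨ m≡m%n+[m/n]*n n W ⟩
      n % W + t * W  ≤⟨ +-monoˡ-≤ (t * W) (<⇒≤ (m%n<n n W)) ⟩
      W + t * W      ≤⟨ +-monoˡ-≤ (t * W) W≤tW ⟩
      t * W + t * W  ≡⟨ cong (_+_ (t * W)) (sym (+-identityʳ (t * W))) ⟩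
      2 * (t * W)    ∎
      where open ≤-Reasoning

  gcd≡1⇒no-common-divisor : ∀ {a b c} → gcd (gcd a b) c ≡ + 1 → ∀ {e} → + e ∣ a → + e ∣ b → + e ∣ c → e ≡ 1
  gcd≡1⇒no-common-divisor gcd≡1 e∣a e∣b e∣c =
    ℕ.∣1⇒≡1 (subst (_ ℕ.∣_) (+-injective gcd≡1) (gcd-greatest (gcd-greatest e∣a e∣b) e∣c))

  record Admissible (a b c : ℤ) : Set where
    field
      a≢0 : a ≢ 0ℤ
      b≢0 : b ≢ 0ℤ
      c≢0 : c ≢ 0ℤ
      no-common-divisor : ∀ {e} → + e ∣ a → + e ∣ b → + e ∣ c → e ≡ 1
      ¬positive : ¬ (0ℤ ℤ.< a × 0ℤ ℤ.< b × 0ℤ ℤ.< c)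
      ¬negative : ¬ (a ℤ.< 0ℤ × b ℤ.< 0ℤ × c ℤ.< 0ℤ)

  Admissible-swap₂₃ : ∀ {a b c} → Admissible a b c → Admissible a c b
  Admissible-swap₂₃ adm = record
    { a≢0 = a≢0 ; b≢0 = c≢0 ; c≢0 = b≢0
    ; no-common-divisor = λ e∣a e∣c e∣b → no-common-divisor e∣a e∣b e∣c
    ; ¬positive = λ (0<a , 0<c , 0<b) → ¬positive (0<a , 0<b , 0<c)
    ; ¬negative = λ (a<0 , c<0 , b<0) → ¬negative (a<0 , b<0 , c<0)
    }
    where open Admissible adm

  Admissible-swap₁₃ : ∀ {a b c} → Admissible a b c → Admissible c b a
  Admissible-swap₁₃ adm = record
    { a≢0 = c≢0 ; b≢0 = b≢0 ; c≢0 = a≢0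
    ; no-common-divisor = λ e∣c e∣b e∣a → no-common-divisor e∣a e∣b e∣c
    ; ¬positive = λ (0<c , 0<b , 0<a) → ¬positive (0<a , 0<b , 0<c)
    ; ¬negative = λ (c<0 , b<0 , a<0) → ¬negative (a<0 , b<0 , c<0)
    }
    where open Admissible adm

  countM≤multiples : ∀ a b c {d} n → + d ∣ a → + d ∣ b → Coprime d ∣ c ∣ →
    countM a b c n (divisibleBy d) ≤ length (filter (DivXY? d) (solutions a b c n))
  countM≤multiples a b c {d} n d∣a d∣b coprime =
    length-filter-mono (λ t → T? (monochromatic (divisibleBy d) t)) (DivXY? d) (solutions a b c n)
      (λ t∈ → monochromatic⇒DivXY {a} {b} {c} d∣a d∣b coprime (proj₂ (∈-solutions⁻ {a} {b} {c} {n} t∈)))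

  multiples≤interior+boundary : ∀ a b c d r n →
    length (filter (DivXY? d) (solutions a b c n)) ≤
    length (filter (InteriorMultiple? d r n) (solutions a b c n)) +
    length (filter (λ t → ¬? (Interior? r n t)) (solutions a b c n))
  multiples≤interior+boundary a b c d r n =
    length-filter-⊎ (DivXY? d) (InteriorMultiple? d r n) (λ t → ¬? (Interior? r n t)) (solutions a b c n) split
    where
    split : ∀ {t} → t ∈ solutions a b c n → DivXY d t → InteriorMultiple d r n t ⊎ ¬ Interior r n t
    split {t} _ divXY with Interior? r n t
    ... | yes interior = inj₁ (divXY , interior)
    ... | no ¬interior = inj₂ ¬interior

  threshold : ℤ → ℤ → ℤ → ℕ → ℕ
  threshold a b c d = 216 * S * (d * S) * (d * S)
    where S = coefficientSum a b c

  -- With t = n / dS we have t ≥ 216 S · dS and n ≤ 2 t · dS, so 9 · 6 · 2S · n ≤ t².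
  boundary-negligible : ∀ a b c {d n} → 0 < d → b ≢ 0ℤ → c ≢ 0ℤ → ManyMultipleSolutions a b c d →
    threshold a b c d ≤ n →
    9 * length (filter (λ t → ¬? (Interior? (2 * coefficientSum a b c) n t)) (solutions a b c n)) ≤
    length (filter (DivXY? d) (solutions a b c n))
  boundary-negligible a b c {d} {n} 0<d b≢0 c≢0 many threshold≤n = begin
    9 * length (filter (λ t → ¬? (Interior? (2 * S) n t)) sols)
                                   ≤⟨ *-monoʳ-≤ 9 (boundary-bound a b c (2 * S) n b≢0 c≢0) ⟩
    9 * (6 * (2 * S * n))          ≡⟨ collect S n ⟩
    108 * S * n                    ≤⟨ *-monoʳ-≤ (108 * S) n≤2tW ⟩
    108 * S * (2 * (t * W))        ≡⟨ regroup S W t ⟩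
    216 * S * W * t                ≤⟨ *-monoˡ-≤ t K≤t ⟩
    t * t                          ≤⟨ many n t tW≤n ⟩
    length (filter (DivAll? d) sols)
      ≤⟨ length-filter-mono (DivAll? d) (DivXY? d) sols (λ _ (d∣x , d∣y , _) → d∣x , d∣y) ⟩
    length (filter (DivXY? d) sols) ∎
    where
    open ≤-Reasoning
    S = coefficientSum a b c
    W = d * S
    sols = solutions a b c n
    0<S : 0 < S
    0<S = ≤-trans (0<∣i∣ c≢0) (m≤n+m ∣ c ∣ (∣ a ∣ + ∣ b ∣))
    0<W : 0 < W
    0<W = *-mono-≤ 0<d 0<S
    instance
      W≢0 : NonZero W
      W≢0 = >-nonZero 0<W
    t = n / W
    bounds = quotient-bounds W (216 * S * W) n (*-mono-≤ (*-mono-≤ (s≤s (z≤n {215})) 0<S) 0<W) threshold≤n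
    K≤t = proj₁ bounds
    tW≤n = proj₁ (proj₂ bounds)
    n≤2tW = proj₂ (proj₂ bounds)
    collect : ∀ S n → 9 * (6 * (2 * S * n)) ≡ 108 * S * n
    collect = ℕ-Solver.solve-∀
    regroup : ∀ S W t → 108 * S * (2 * (t * W)) ≡ 216 * S * W * t
    regroup = ℕ-Solver.solve-∀

  divisible-pair⇒Uncommon : ∀ {a b c d} → Admissible a b c → 3 ≤ d → + d ∣ a → + d ∣ b → Uncommon 8 a b c
  divisible-pair⇒Uncommon {a} {b} {c} {d} adm 3≤d d∣a d∣b = threshold a b c d , λ n threshold≤n →
    divisibleBy d , density-arithmetic {B = boundary n}
      (countM≤multiples a b c n d∣a d∣b coprime)
      (multiples≤interior+boundary a b c d (2 * coefficientSum a b c) n)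
      (9*interior≤countT a b c 3≤d coprime n)
      (boundary-negligible a b c 0<d b≢0 c≢0
        (mixed-signs⇒ManyMultipleSolutions 0<d a≢0 b≢0 c≢0 ¬positive ¬negative) threshold≤n)
    where
    open Admissible adm
    boundary : ℕ → ℕ
    boundary n = length (filter (λ t → ¬? (Interior? (2 * coefficientSum a b c) n t)) (solutions a b c n))
    0<d : 0 < d
    0<d = ≤-trans z<s 3≤d
    coprime : Coprime d ∣ c ∣
    coprime (e∣d , e∣c) = no-common-divisor (∣-trans e∣d d∣a) (∣-trans e∣d d∣b) e∣c

open Uncommonness
  using (Uncommon; Admissible; Admissible-swap₂₃; Admissible-swap₁₃; gcd≡1⇒no-common-divisor;
         divisible-pair⇒Uncommon; Uncommon-swap₂₃; Uncommon-swap₁₃)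

open import Data.Nat using (ℕ; _≤_; _+_; _*_; s≤s; z≤n)
open import Data.Integer using (ℤ; +_; 0ℤ; _<_)
open import Data.Integer.GCD using (gcd)
open import Data.Integer.Divisibility using (_∣_)
open import Data.Product using (_×_; Σ; _,_)
open import Data.Sum using (_⊎_; inj₁; inj₂)
open import Relation.Nullary using (¬_)
open import Relation.Binary.PropositionalEquality using (_≡_; _≢_)

proposition2p3 : (a b c : ℤ) → a ≢ 0ℤ → b ≢ 0ℤ → c ≢ 0ℤ →
    gcd (gcd a b) c ≡ + 1 →
    ¬ (0ℤ < a × 0ℤ < b × 0ℤ < c) →
    ¬ (a < 0ℤ × b < 0ℤ × c < 0ℤ) →
    (Σ ℕ λ d → 3 ≤ d × ((+ d ∣ a × + d ∣ b) ⊎ (+ d ∣ a × + d ∣ c) ⊎ (+ d ∣ b × + d ∣ c))) →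
    Σ ℕ λ k → 1 ≤ k × (Σ ℕ λ N → (n : ℕ) → N ≤ n →
      Σ Coloring λ f → 4 * k * countM a b c n f + 4 * countT a b c n ≤ k * countT a b c n)
proposition2p3 a b c a≢0 b≢0 c≢0 gcd≡1 ¬positive ¬negative (d , 3≤d , divisible-pair) =
  8 , s≤s z≤n , uncommon divisible-pair
  where
  admissible : Admissible a b c
  admissible = record
    { a≢0 = a≢0 ; b≢0 = b≢0 ; c≢0 = c≢0
    ; no-common-divisor = gcd≡1⇒no-common-divisor {a} {b} {c} gcd≡1
    ; ¬positive = ¬positive ; ¬negative = ¬negative
    }
  uncommon : (+ d ∣ a × + d ∣ b) ⊎ (+ d ∣ a × + d ∣ c) ⊎ (+ d ∣ b × + d ∣ c) → Uncommon 8 a b c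
  uncommon (inj₁ (d∣a , d∣b)) = divisible-pair⇒Uncommon admissible 3≤d d∣a d∣b
  uncommon (inj₂ (inj₁ (d∣a , d∣c))) =
    Uncommon-swap₂₃ {8} a b c (divisible-pair⇒Uncommon (Admissible-swap₂₃ admissible) 3≤d d∣a d∣c)
  uncommon (inj₂ (inj₂ (d∣b , d∣c))) =
    Uncommon-swap₁₃ {8} a b c (divisible-pair⇒Uncommon (Admissible-swap₁₃ admissible) 3≤d d∣c d∣b)
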